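{- Let $R=R_1\,\Box\,R_2\,\Box\cdots\Box\,R_t$ be the Cartesian product of nontrivial graphs $R_1,\dots,R_t$ (each with more than one vertex), and let $n$ be a positive integer. Then $R$ is a daisy cube with $\mathrm{idim}(R)=n$ if and only if each $R_i$ is a daisy cube with $\mathrm{idim}(R_i)=n_i$, where $n_i$ is a positive integer for all $1\le i\le t$ and $n=n_1+n_2+\cdots+n_t$.
   Context: The Cartesian product $R_1\Box\cdots\Box R_t$ has vertex set $V(R_1)\times\cdots\times V(R_t)$, two tuples adjacent iff they differ in exactly one coordinate $j$ and the $j$-th coordinates are adjacent in $R_j$. Let $\mathcal{B}^n=\{0,1\}^n$ with componentwise order and $Q_n$ the hypercube on $\mathcal{B}^n$. A daisy cube is a graph isomorphic to $\langle\{u\in\mathcal{B}^n: u\le x\text{ for some }x\in X\}\rangle\subseteq Q_n$ for some nonempty $X\subseteq\mathcal{B}^n$. $\mathrm{idim}$ denotes isometric dimension: the least $n$ such that the graph embeds isometrically into $Q_n$. -}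

module Defs where

open import Data.Nat using (ℕ; zero; suc; _+_; _<_)
open import Data.Fin using (Fin; zero; suc)
open import Data.Bool using (Bool; true; false; T; _∧_; _∨_)
open import Data.Vec using (Vec; []; _∷_)
open import Data.List using (List; []; _∷_)
open import Data.Product using (Σ; ∃; _×_; _,_; proj₁)
open import Data.Sum using (_⊎_)
open import Data.Unit using (⊤; tt)
open import Data.Empty using (⊥)
open import Relation.Nullary using (¬_)
open import Relation.Binary.PropositionalEquality using (_≡_; _≢_)
open import Function using (_∘_)
open import Function.Bundles using (_⇔_)

record Graph : Set₁ where
  field
    V     : Set
    Adj   : V → V → Set
    sym   : ∀ {u v} → Adj u v → Adj v u
    irrefl : ∀ {u} → ¬ Adj u u
open Graph public

Nontrivial : Graph → Set
Nontrivial G = Σ (V G) λ u → Σ (V G) λ v → u ≢ v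

-- Vertices are t-tuples (nested pairs); two tuples are adjacent iff they
-- differ in exactly one coordinate j and the j-th coordinates are adjacent.

ProdV : (t : ℕ) → (Fin t → Graph) → Set
ProdV zero    R = ⊤
ProdV (suc t) R = V (R zero) × ProdV t (R ∘ suc)

ProdAdj : (t : ℕ) (R : Fin t → Graph) → ProdV t R → ProdV t R → Set
ProdAdj zero    R _ _ = ⊥
ProdAdj (suc t) R (x , xs) (y , ys) =
  (Adj (R zero) x y × xs ≡ ys) ⊎ (x ≡ y × ProdAdj t (R ∘ suc) xs ys)

private
  prodSym : (t : ℕ) (R : Fin t → Graph) {u v : ProdV t R} →
            ProdAdj t R u v → ProdAdj t R v u
  prodSym zero R ()
  prodSym (suc t) R (Data.Sum.inj₁ (a , Relation.Binary.PropositionalEquality.refl)) =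
    Data.Sum.inj₁ (sym (R zero) a , Relation.Binary.PropositionalEquality.refl)
  prodSym (suc t) R (Data.Sum.inj₂ (Relation.Binary.PropositionalEquality.refl , a)) =
    Data.Sum.inj₂ (Relation.Binary.PropositionalEquality.refl , prodSym t (R ∘ suc) a)

  prodIrr : (t : ℕ) (R : Fin t → Graph) {u : ProdV t R} → ¬ ProdAdj t R u u
  prodIrr zero R ()
  prodIrr (suc t) R (Data.Sum.inj₁ (a , _)) = irrefl (R zero) a
  prodIrr (suc t) R (Data.Sum.inj₂ (_ , a)) = prodIrr t (R ∘ suc) a

CartProd : (t : ℕ) → (Fin t → Graph) → Graph
CartProd t R = record
  { V = ProdV t R ; Adj = ProdAdj t R ; sym = prodSym t R ; irrefl = prodIrr t R }

QAdj : {m : ℕ} → Vec Bool m → Vec Bool m → Set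
QAdj []       []       = ⊥
QAdj (x ∷ xs) (y ∷ ys) = (x ≢ y × xs ≡ ys) ⊎ (x ≡ y × QAdj xs ys)

private
  qSym : {m : ℕ} {u v : Vec Bool m} → QAdj u v → QAdj v u
  qSym {u = []} {[]} ()
  qSym {u = x ∷ xs} {y ∷ ys} (Data.Sum.inj₁ (ne , Relation.Binary.PropositionalEquality.refl)) =
    Data.Sum.inj₁ ((λ e → ne (Relation.Binary.PropositionalEquality.sym e)) , Relation.Binary.PropositionalEquality.refl)
  qSym {u = x ∷ xs} {y ∷ ys} (Data.Sum.inj₂ (Relation.Binary.PropositionalEquality.refl , a)) =
    Data.Sum.inj₂ (Relation.Binary.PropositionalEquality.refl , qSym a)

  qIrr : {m : ℕ} {u : Vec Bool m} → ¬ QAdj u u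
  qIrr {u = []} ()
  qIrr {u = x ∷ xs} (Data.Sum.inj₁ (ne , _)) = ne Relation.Binary.PropositionalEquality.refl
  qIrr {u = x ∷ xs} (Data.Sum.inj₂ (_ , a)) = qIrr a

Q : ℕ → Graph
Q m = record { V = Vec Bool m ; Adj = QAdj ; sym = qSym ; irrefl = qIrr }

-- Componentwise order on 𝓑^m (boolean-valued so that membership proofs are unique).
leqᵇ : {m : ℕ} → Vec Bool m → Vec Bool m → Bool
leqᵇ []            []       = true
leqᵇ (true  ∷ xs) (true  ∷ ys) = leqᵇ xs ys
leqᵇ (true  ∷ xs) (false ∷ ys) = false
leqᵇ (false ∷ xs) (_     ∷ ys) = leqᵇ xs ys

belowSome : {m : ℕ} → List (Vec Bool m) → Vec Bool m → Bool
belowSome []       u = false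
belowSome (x ∷ X) u = leqᵇ u x ∨ belowSome X u

DaisyGraph : (m : ℕ) → List (Vec Bool m) → Graph
DaisyGraph m X = record
  { V = Σ (Vec Bool m) (λ u → T (belowSome X u))
  ; Adj = λ u v → QAdj (proj₁ u) (proj₁ v)
  ; sym = sym (Q m)
  ; irrefl = irrefl (Q m)
  }

record _≅_ (G H : Graph) : Set where
  field
    to      : V G → V H
    from    : V H → V G
    from∘to : ∀ u → from (to u) ≡ u
    to∘from : ∀ v → to (from v) ≡ v
    adj     : ∀ u v → Adj G u v ⇔ Adj H (to u) (to v)

NonEmpty : {A : Set} → List A → Set
NonEmpty []      = ⊥
NonEmpty (_ ∷ _) = ⊤

IsDaisyCube : Graph → Set
IsDaisyCube G = Σ ℕ λ m → Σ (List (Vec Bool m)) λ X → NonEmpty X × (G ≅ DaisyGraph m X)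

data Walk (G : Graph) : V G → V G → ℕ → Set where
  here : ∀ {u} → Walk G u u zero
  step : ∀ {u v w k} → Adj G u v → Walk G v w k → Walk G u w (suc k)

Dist : (G : Graph) → V G → V G → ℕ → Set
Dist G u v d = Walk G u v d × (∀ k → k < d → ¬ Walk G u v k)

IsIsometricEmbedding : (G : Graph) (m : ℕ) → (V G → Vec Bool m) → Set
IsIsometricEmbedding G m f = ∀ u v d → Dist G u v d ⇔ Dist (Q m) (f u) (f v) d

EmbedsIsometrically : Graph → ℕ → Set
EmbedsIsometrically G m = Σ (V G → Vec Bool m) (IsIsometricEmbedding G m)

Idim : Graph → ℕ → Set
Idim G m = EmbedsIsometrically G m × (∀ k → k < m → ¬ EmbedsIsometrically G k)

sumFin : (t : ℕ) → (Fin t → ℕ) → ℕ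
sumFin zero    f = 0
sumFin (suc t) f = f zero + sumFin t (f ∘ suc)

-- A daisy cube is, up to isomorphism, the subgraph ⟪ D ⟫ of Q_m induced by a down-set D ∋ 𝟘.
-- Such a subgraph is isometric in Q_m, since a shortest path may clear bits before setting any.
-- If D also contains every unit vector, idim ⟪ D ⟫ = m: an isometric embedding into Q_k sends the
-- m neighbours of 𝟘 to neighbours of the image of 𝟘 across m distinct coordinates. Coordinates
-- unused by D can be deleted, so "daisy cube with idim m" means "such a spanning representation
-- in dimension m". Spanning representations of G and H concatenate to one of G □ H in dimension
-- a + b. Conversely, if G □ H ≅ ⟪ D ⟫, the layer G × {b} through the preimage of 𝟘 is again a
-- down-set: a point of D below the layer but outside it would give, after projecting onto G and lifting
-- back to the layer, a walk from 𝟘 shorter than its Hamming distance. Uniqueness of idim then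
-- forces n to be the sum of the dimensions of the factors.

module Submission where

open import Defs
open import Data.Bool using (Bool; true; false; T; not; _∧_)
open import Data.Bool.Properties using (T?; T-irrelevant; T-∧; T-∨) renaming (_≟_ to _≟ᵇ_)
open import Data.Empty using (⊥-elim)
open import Data.Fin using (Fin; zero; suc)
open import Data.Fin.Properties using (injective⇒≤; all?; ¬∀⟶∃¬)
open import Data.List using (List; []; _∷_; filter; cartesianProductWith)
open import Data.List.Membership.Propositional using (_∈_)
open import Data.List.Membership.Propositional.Properties using (∈-filter⁺; ∈-filter⁻; ∈-cartesianProductWith⁺)
open import Data.List.Relation.Unary.Any using (here; there)
open import Data.Nat using (ℕ; zero; suc; _+_; _≤_; _<_; z≤n; s≤s)
open import Data.Nat.Properties
  using (suc-injective; +-suc; +-comm; ≤-trans; ≤-antisym; m≤n+m; m≤n⇒m≤1+n; +-monoˡ-≤; +-monoʳ-≤; +-mono-<-≤; <-cmp; ≮⇒≥; <⇒≱)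
open import Data.Product using (Σ; ∃; _×_; _,_; proj₁; proj₂; swap)
import Data.Product as Product
import Data.Sum as Sum
open import Data.Sum using (_⊎_; inj₁; inj₂)
open import Data.Unit using (tt)
open import Data.Vec using (Vec; []; _∷_; _++_; take; drop; replicate; updateAt; lookup; insertAt; removeAt)
open import Data.Vec.Properties
  using (∷-injectiveʳ; ≡-dec; ++-injective; take++drop≡id; removeAt-insertAt; insertAt-removeAt)
open import Function using (_∘_; id)
open import Function.Bundles using (_⇔_; mk⇔; Equivalence)
open import Function.Properties.Equivalence using () renaming (sym to ⇔-sym; trans to ⇔-trans)
open import Function.Construct.Identity using () renaming (equivalence to ⇔-refl)
open import Relation.Nullary using (¬_; Dec; map′; yes; no)
open import Relation.Nullary.Decidable using (⌊_⌋; toWitness; fromWitness)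
open import Relation.Binary.Definitions using (DecidableEquality; tri<; tri≈; tri>)
open import Relation.Binary.PropositionalEquality as ≡
  using (_≡_; _≢_; refl; trans; cong; cong₂; subst)

open _≅_
module ⇔ = Equivalence

-- Bit vectors and Hamming distance

𝟘 : {m : ℕ} → Vec Bool m
𝟘 = replicate _ false

unit : {m : ℕ} → Fin m → Vec Bool m
unit zero    = true ∷ 𝟘
unit (suc c) = false ∷ unit c

_≼_ : {m : ℕ} → Vec Bool m → Vec Bool m → Set
u ≼ v = T (leqᵇ u v)

≼-refl : {m : ℕ} (u : Vec Bool m) → u ≼ u
≼-refl []          = tt
≼-refl (true  ∷ u) = ≼-refl u
≼-refl (false ∷ u) = ≼-refl u

≼-trans : {m : ℕ} (u v w : Vec Bool m) → u ≼ v → v ≼ w → u ≼ w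
≼-trans []          []          []          _   _   = tt
≼-trans (true  ∷ u) (true  ∷ v) (true  ∷ w) u≼v v≼w = ≼-trans u v w u≼v v≼w
≼-trans (false ∷ u) (true  ∷ v) (true  ∷ w) u≼v v≼w = ≼-trans u v w u≼v v≼w
≼-trans (false ∷ u) (false ∷ v) (true  ∷ w) u≼v v≼w = ≼-trans u v w u≼v v≼w
≼-trans (false ∷ u) (false ∷ v) (false ∷ w) u≼v v≼w = ≼-trans u v w u≼v v≼w
≼-trans (true  ∷ u) (true  ∷ v) (false ∷ w) _   ()
≼-trans (false ∷ u) (true  ∷ v) (false ∷ w) _   ()

𝟘-≼ : {m : ℕ} (v : Vec Bool m) → 𝟘 ≼ v
𝟘-≼ []          = tt
𝟘-≼ (true  ∷ v) = 𝟘-≼ v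
𝟘-≼ (false ∷ v) = 𝟘-≼ v

bitDist : Bool → Bool → ℕ
bitDist true  true  = 0
bitDist false false = 0
bitDist true  false = 1
bitDist false true  = 1

ham : {m : ℕ} → Vec Bool m → Vec Bool m → ℕ
ham []      []      = 0
ham (x ∷ u) (y ∷ v) = bitDist x y + ham u v

ham-self : {m : ℕ} (u : Vec Bool m) → ham u u ≡ 0
ham-self []          = refl
ham-self (true  ∷ u) = ham-self u
ham-self (false ∷ u) = ham-self u

ham≡0⇒≡ : {m : ℕ} (u v : Vec Bool m) → ham u v ≡ 0 → u ≡ v
ham≡0⇒≡ []          []          _  = refl
ham≡0⇒≡ (true  ∷ u) (true  ∷ v) eq = cong (true ∷_) (ham≡0⇒≡ u v eq)
ham≡0⇒≡ (false ∷ u) (false ∷ v) eq = cong (false ∷_) (ham≡0⇒≡ u v eq)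
ham≡0⇒≡ (true  ∷ u) (false ∷ v) ()
ham≡0⇒≡ (false ∷ u) (true  ∷ v) ()

ham≡1⇒flip : {m : ℕ} (u v : Vec Bool m) → ham u v ≡ 1 → ∃ λ j → v ≡ updateAt u j not
ham≡1⇒flip []          []          ()
ham≡1⇒flip (true  ∷ u) (true  ∷ v) eq = let j , v≡ = ham≡1⇒flip u v eq in suc j , cong (true ∷_) v≡
ham≡1⇒flip (false ∷ u) (false ∷ v) eq = let j , v≡ = ham≡1⇒flip u v eq in suc j , cong (false ∷_) v≡
ham≡1⇒flip (true  ∷ u) (false ∷ v) eq = zero , cong (false ∷_) (≡.sym (ham≡0⇒≡ u v (suc-injective eq)))
ham≡1⇒flip (false ∷ u) (true  ∷ v) eq = zero , cong (true ∷_) (≡.sym (ham≡0⇒≡ u v (suc-injective eq)))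

ham-𝟘-unit : {m : ℕ} (c : Fin m) → ham 𝟘 (unit c) ≡ 1
ham-𝟘-unit {suc m} zero = cong suc (ham-self (𝟘 {m}))
ham-𝟘-unit (suc c)      = ham-𝟘-unit c

ham-𝟘-split : {m : ℕ} (u v : Vec Bool m) → v ≼ u → ham 𝟘 v + ham v u ≡ ham 𝟘 u
ham-𝟘-split []          []          _   = refl
ham-𝟘-split (true  ∷ u) (true  ∷ v) v≼u = cong suc (ham-𝟘-split u v v≼u)
ham-𝟘-split (false ∷ u) (false ∷ v) v≼u = ham-𝟘-split u v v≼u
ham-𝟘-split (true  ∷ u) (false ∷ v) v≼u = trans (+-suc (ham 𝟘 v) (ham v u)) (cong suc (ham-𝟘-split u v v≼u))

bitDist≤1 : (x y : Bool) → bitDist x y ≤ 1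
bitDist≤1 true  true  = z≤n
bitDist≤1 false false = z≤n
bitDist≤1 true  false = s≤s z≤n
bitDist≤1 false true  = s≤s z≤n

ham-QAdj : {m : ℕ} (u v w : Vec Bool m) → QAdj u v → ham u w ≤ suc (ham v w)
ham-QAdj []      []       []      ()
ham-QAdj (x ∷ u) (y ∷ .u) (z ∷ w) (inj₁ (_ , refl)) =
  ≤-trans (+-monoˡ-≤ (ham u w) (bitDist≤1 x z)) (s≤s (m≤n+m (ham u w) (bitDist y z)))
ham-QAdj (x ∷ u) (.x ∷ v) (z ∷ w) (inj₂ (refl , adj)) =
  subst (bitDist x z + ham u w ≤_) (+-suc (bitDist x z) (ham v w)) (+-monoʳ-≤ (bitDist x z) (ham-QAdj u v w adj))

-- Walks and distances in down-closed subgraphs of the hypercube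

mapWalk : {G H : Graph} (f : V G → V H) → (∀ {u v} → Adj G u v → Adj H (f u) (f v)) →
          ∀ {u v k} → Walk G u v k → Walk H (f u) (f v) k
mapWalk f f-adj here         = here
mapWalk f f-adj (step uv vw) = step (f-adj uv) (mapWalk f f-adj vw)

_++ʷ_ : {G : Graph} {u v w : V G} {k l : ℕ} → Walk G u v k → Walk G v w l → Walk G u w (k + l)
here       ++ʷ q = q
step uv p  ++ʷ q = step uv (p ++ʷ q)

snocʷ : {G : Graph} {u v w : V G} {k : ℕ} → Walk G u v k → Adj G v w → Walk G u w (suc k)
snocʷ {k = k} p vw = subst (Walk _ _ _) (+-comm k 1) (p ++ʷ step vw here)

substʷ : {G : Graph} {u u′ v v′ : V G} {k : ℕ} → u ≡ u′ → v ≡ v′ → Walk G u v k → Walk G u′ v′ k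
substʷ refl refl p = p

walk⇒ham≤ : {G : Graph} {m : ℕ} (f : V G → Vec Bool m) → (∀ {u v} → Adj G u v → QAdj (f u) (f v)) →
            ∀ {u v k} → Walk G u v k → ham (f u) (f v) ≤ k
walk⇒ham≤ f f-adj {u} here = subst (_≤ 0) (≡.sym (ham-self (f u))) z≤n
walk⇒ham≤ f f-adj {u} {w} (step {v = v} uv vw) =
  ≤-trans (ham-QAdj (f u) (f v) (f w) (f-adj uv)) (s≤s (walk⇒ham≤ f f-adj vw))

Dist⇔≡ : {G : Graph} {u v : V G} (h : ℕ) → Walk G u v h → (∀ {k} → Walk G u v k → h ≤ k) →
         ∀ d → Dist G u v d ⇔ d ≡ h
Dist⇔≡ {G} {u} {v} h geodesic shortest d = mk⇔ dist⇒≡ ≡⇒dist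
  where
  dist⇒≡ : Dist G u v d → d ≡ h
  dist⇒≡ (p , minimal) = ≤-antisym (≮⇒≥ (λ h<d → minimal h h<d geodesic)) (shortest p)
  ≡⇒dist : d ≡ h → Dist G u v d
  ≡⇒dist refl = geodesic , λ k k<h p → <⇒≱ k<h (shortest p)

Induced : (m : ℕ) → (Vec Bool m → Bool) → Graph
Induced m p = record
  { V      = Σ (Vec Bool m) (T ∘ p)
  ; Adj    = λ u v → QAdj (proj₁ u) (proj₁ v)
  ; sym    = sym (Q m)
  ; irrefl = irrefl (Q m)
  }

Induced-≡ : {m : ℕ} {p : Vec Bool m → Bool} {u v : Vec Bool m} → u ≡ v → (pu : T (p u)) (pv : T (p v)) →
            _≡_ {A = V (Induced m p)} (u , pu) (v , pv)
Induced-≡ refl pu pv = cong (_ ,_) (T-irrelevant pu pv)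

DownClosed : {m : ℕ} → (Vec Bool m → Bool) → Set
DownClosed p = ∀ u v → v ≼ u → T (p u) → T (p v)

DownClosed-∷ : {m : ℕ} {p : Vec Bool (suc m) → Bool} → DownClosed p → (x : Bool) → DownClosed (p ∘ (x ∷_))
DownClosed-∷ p↓ true  u v = p↓ (true ∷ u) (true ∷ v)
DownClosed-∷ p↓ false u v = p↓ (false ∷ u) (false ∷ v)

clear-head : {m : ℕ} {p : Vec Bool (suc m) → Bool} → DownClosed p →
             (u : Vec Bool m) → T (p (true ∷ u)) → T (p (false ∷ u))
clear-head p↓ u = p↓ (true ∷ u) (false ∷ u) (≼-refl u)

∷-walk : {m : ℕ} (p : Vec Bool (suc m) → Bool) (x : Bool) {u v : Vec Bool m}
            {pu : T (p (x ∷ u))} {pv : T (p (x ∷ v))} {k : ℕ} →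
            Walk (Induced m (p ∘ (x ∷_))) (u , pu) (v , pv) k →
            Walk (Induced (suc m) p) (x ∷ u , pu) (x ∷ v , pv) k
∷-walk p x = mapWalk (λ (u , pu) → x ∷ u , pu) (λ adj → inj₂ (refl , adj))

geodesic : {m : ℕ} (p : Vec Bool m → Bool) → DownClosed p →
           (u v : Vec Bool m) (pu : T (p u)) (pv : T (p v)) → Walk (Induced m p) (u , pu) (v , pv) (ham u v)
geodesic p p↓ [] [] pu pv = subst (λ pv → Walk (Induced 0 p) ([] , pu) ([] , pv) 0) (T-irrelevant pu pv) here
geodesic p p↓ (true ∷ u) (true ∷ v) pu pv =
  ∷-walk p true (geodesic (p ∘ (true ∷_)) (DownClosed-∷ p↓ true) u v pu pv)
geodesic p p↓ (false ∷ u) (false ∷ v) pu pv =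
  ∷-walk p false (geodesic (p ∘ (false ∷_)) (DownClosed-∷ p↓ false) u v pu pv)
geodesic p p↓ (true ∷ u) (false ∷ v) pu pv =
  step (inj₁ ((λ ()) , refl))
       (∷-walk p false (geodesic (p ∘ (false ∷_)) (DownClosed-∷ p↓ false) u v (clear-head p↓ u pu) pv))
geodesic p p↓ (false ∷ u) (true ∷ v) pu pv =
  snocʷ (∷-walk p false (geodesic (p ∘ (false ∷_)) (DownClosed-∷ p↓ false) u v pu (clear-head p↓ v pv)))
        (inj₁ ((λ ()) , refl))

Dist-Induced : {m : ℕ} {p : Vec Bool m → Bool} → DownClosed p →
               ∀ u v d → Dist (Induced m p) u v d ⇔ d ≡ ham (proj₁ u) (proj₁ v)
Dist-Induced {p = p} p↓ (u , pu) (v , pv) d =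
  Dist⇔≡ (ham u v) (geodesic p p↓ u v pu pv) (walk⇒ham≤ proj₁ id) d

Dist-Q : {m : ℕ} (u v : Vec Bool m) (d : ℕ) → Dist (Q m) u v d ⇔ d ≡ ham u v
Dist-Q {m} u v d = Dist⇔≡ (ham u v) (mapWalk proj₁ id (geodesic (λ _ → true) (λ _ _ _ _ → tt) u v tt tt))
                          (walk⇒ham≤ {Q m} id id) d

-- Isomorphisms and isometric dimension

≡⇒⇔ : {A B : Set} → A ≡ B → A ⇔ B
≡⇒⇔ refl = ⇔-refl _

≅-refl : (G : Graph) → G ≅ G
≅-refl G = record
  { to = id ; from = id ; from∘to = λ _ → refl ; to∘from = λ _ → refl ; adj = λ _ _ → ⇔-refl _ }

≅-sym : {G H : Graph} → G ≅ H → H ≅ G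
≅-sym {G} {H} φ = record
  { to      = from φ
  ; from    = to φ
  ; from∘to = to∘from φ
  ; to∘from = from∘to φ
  ; adj     = λ u v → ⇔-sym (⇔-trans (adj φ (from φ u) (from φ v))
                                     (≡⇒⇔ (cong₂ (Adj H) (to∘from φ u) (to∘from φ v))))
  }

≅-trans : {G H K : Graph} → G ≅ H → H ≅ K → G ≅ K
≅-trans φ ψ = record
  { to      = to ψ ∘ to φ
  ; from    = from φ ∘ from ψ
  ; from∘to = λ u → trans (cong (from φ) (from∘to ψ (to φ u))) (from∘to φ u)
  ; to∘from = λ w → trans (cong (to ψ) (to∘from φ (from ψ w))) (to∘from ψ w)
  ; adj     = λ u v → ⇔-trans (adj φ u v) (adj ψ (to φ u) (to φ v))
  }

≅-walk : {G H : Graph} (φ : G ≅ H) → ∀ {u v k} → Walk G u v k → Walk H (to φ u) (to φ v) k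
≅-walk φ = mapWalk (to φ) (⇔.to (adj φ _ _))

≅-walk⁻ : {G H : Graph} (φ : G ≅ H) → ∀ {u v k} → Walk H (to φ u) (to φ v) k → Walk G u v k
≅-walk⁻ φ p = substʷ (from∘to φ _) (from∘to φ _) (≅-walk (≅-sym φ) p)

≅-Dist : {G H : Graph} (φ : G ≅ H) → ∀ u v d → Dist G u v d ⇔ Dist H (to φ u) (to φ v) d
≅-Dist φ u v d = mk⇔
  (λ (p , minimal) → ≅-walk φ p , λ k k<d q → minimal k k<d (≅-walk⁻ φ q))
  (λ (p , minimal) → ≅-walk⁻ φ p , λ k k<d q → minimal k k<d (≅-walk φ q))

≅-embeds : {G H : Graph} {k : ℕ} → G ≅ H → EmbedsIsometrically H k → EmbedsIsometrically G k
≅-embeds φ (f , f-isometric) =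
  f ∘ to φ , λ u v d → ⇔-trans (≅-Dist φ u v d) (f-isometric (to φ u) (to φ v) d)

≅-Idim : {G H : Graph} {k : ℕ} → G ≅ H → Idim H k → Idim G k
≅-Idim φ (embeds , minimal) = ≅-embeds φ embeds , λ j j<k → minimal j j<k ∘ ≅-embeds (≅-sym φ)

Idim-unique : {G : Graph} {a b : ℕ} → Idim G a → Idim G b → a ≡ b
Idim-unique {a = a} {b} (embeds-a , minimal-a) (embeds-b , minimal-b) with <-cmp a b
... | tri< a<b _ _ = ⊥-elim (minimal-b a a<b embeds-a)
... | tri≈ _ a≡b _ = a≡b
... | tri> _ _ b<a = ⊥-elim (minimal-a b b<a embeds-b)

≅-injective : {G H : Graph} (φ : G ≅ H) {x y : V G} → to φ x ≡ to φ y → x ≡ y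
≅-injective φ {x} {y} eq = begin
  x                 ≡⟨ from∘to φ x ⟨
  from φ (to φ x)   ≡⟨ cong (from φ) eq ⟩
  from φ (to φ y)   ≡⟨ from∘to φ y ⟩
  y                 ∎
  where open ≡.≡-Reasoning

≅-Induced-injective : {G : Graph} {m : ℕ} {p : Vec Bool m → Bool} (φ : G ≅ Induced m p) {x y : V G} →
                      proj₁ (to φ x) ≡ proj₁ (to φ y) → x ≡ y
≅-Induced-injective φ eq = ≅-injective φ (Induced-≡ eq _ _)

≅-Induced-≟ : {G : Graph} {m : ℕ} {p : Vec Bool m → Bool} → G ≅ Induced m p → DecidableEquality (V G)
≅-Induced-≟ φ x y =
  map′ (≅-Induced-injective φ) (cong (proj₁ ∘ to φ)) (≡-dec _≟ᵇ_ (proj₁ (to φ x)) (proj₁ (to φ y)))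

Spanning : {m : ℕ} → (Vec Bool m → Bool) → Set
Spanning {m} p = (c : Fin m) → T (p (unit c))

unit-injective : {m : ℕ} {c c′ : Fin m} → unit c ≡ unit c′ → c ≡ c′
unit-injective {c = zero}  {zero}   _  = refl
unit-injective {c = suc c} {suc c′} eq = cong suc (unit-injective (∷-injectiveʳ eq))

isometric-ham : {m k : ℕ} {p : Vec Bool m → Bool} → DownClosed p → {f : V (Induced m p) → Vec Bool k} →
                IsIsometricEmbedding (Induced m p) k f → ∀ u v → ham (f u) (f v) ≡ ham (proj₁ u) (proj₁ v)
isometric-ham p↓ {f} f-isometric u v =
  ≡.sym (⇔.to (Dist-Q (f u) (f v) _) (⇔.to (f-isometric u v _) (⇔.from (Dist-Induced p↓ u v _) refl)))

Induced-embeds⇒≤ : {m k : ℕ} {p : Vec Bool m → Bool} → DownClosed p → T (p 𝟘) → Spanning p →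
                   EmbedsIsometrically (Induced m p) k → m ≤ k
Induced-embeds⇒≤ {m} {k} {p} p↓ p𝟘 spanning (f , f-isometric) = injective⇒≤ flipped-injective
  where
  o : V (Induced m p)
  o = 𝟘 , p𝟘
  e : Fin m → V (Induced m p)
  e c = unit c , spanning c
  -- The bit flipped from f o to f (e c) determines c, so m ≤ k.
  flip-of : (c : Fin m) → ∃ λ j → f (e c) ≡ updateAt (f o) j not
  flip-of c = ham≡1⇒flip (f o) (f (e c)) (trans (isometric-ham p↓ f-isometric o (e c)) (ham-𝟘-unit c))
  flipped-injective : {c c′ : Fin m} → proj₁ (flip-of c) ≡ proj₁ (flip-of c′) → c ≡ c′
  flipped-injective {c} {c′} same-flip = unit-injective (ham≡0⇒≡ (unit c) (unit c′) (begin
    ham (unit c) (unit c′)      ≡⟨ isometric-ham p↓ f-isometric (e c) (e c′) ⟨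
    ham (f (e c)) (f (e c′))    ≡⟨ cong (ham (f (e c))) same-image ⟨
    ham (f (e c)) (f (e c))     ≡⟨ ham-self (f (e c)) ⟩
    0                           ∎))
    where
    open ≡.≡-Reasoning
    same-image : f (e c) ≡ f (e c′)
    same-image = trans (proj₂ (flip-of c))
                       (trans (cong (λ j → updateAt (f o) j not) same-flip) (≡.sym (proj₂ (flip-of c′))))

Idim-Induced : {m : ℕ} {p : Vec Bool m → Bool} → DownClosed p → T (p 𝟘) → Spanning p → Idim (Induced m p) m
Idim-Induced p↓ p𝟘 spanning =
  (proj₁ , λ u v d → ⇔-trans (Dist-Induced p↓ u v d) (⇔-sym (Dist-Q (proj₁ u) (proj₁ v) d))) ,
  λ k k<m embeds → <⇒≱ k<m (Induced-embeds⇒≤ p↓ p𝟘 spanning embeds)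

-- Daisy representations

record DownSet (m : ℕ) : Set where
  field
    member     : Vec Bool m → Bool
    downClosed : DownClosed member
    has-𝟘      : T (member 𝟘)

⟪_⟫ : {m : ℕ} → DownSet m → Graph
⟪_⟫ {m} D = Induced m (DownSet.member D)

DaisyRep : Graph → ℕ → Set
DaisyRep G m = Σ (DownSet m) λ D → G ≅ ⟪ D ⟫

SpanningRep : Graph → ℕ → Set
SpanningRep G m = Σ (DownSet m) λ D → Spanning (DownSet.member D) × G ≅ ⟪ D ⟫

≅-DaisyRep : {G H : Graph} {m : ℕ} → G ≅ H → DaisyRep H m → DaisyRep G m
≅-DaisyRep φ (D , ψ) = D , ≅-trans φ ψ

Idim-SpanningRep : {G : Graph} {m : ℕ} → SpanningRep G m → Idim G m
Idim-SpanningRep (D , spanning , φ) = ≅-Idim φ (Idim-Induced downClosed has-𝟘 spanning)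
  where open DownSet D

DaisyRep-dim>0 : {G : Graph} {m : ℕ} → Nontrivial G → DaisyRep G m → 0 < m
DaisyRep-dim>0 {m = zero}  (x , y , x≢y) (D , φ) = ⊥-elim (x≢y (≅-Induced-injective φ (no-vectors _ _)))
  where
  no-vectors : (u v : Vec Bool 0) → u ≡ v
  no-vectors [] [] = refl
DaisyRep-dim>0 {m = suc m} _ _ = s≤s z≤n

unit-≼ : {m : ℕ} (v : Vec Bool m) (c : Fin m) → lookup v c ≡ true → unit c ≼ v
unit-≼ (true  ∷ v) zero    _  = 𝟘-≼ v
unit-≼ (true  ∷ v) (suc c) eq = unit-≼ v c eq
unit-≼ (false ∷ v) (suc c) eq = unit-≼ v c eq

unit∉⇒lookup≡false : {m : ℕ} {p : Vec Bool m → Bool} → DownClosed p → (c : Fin m) → ¬ T (p (unit c)) →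
                    ∀ v → T (p v) → lookup v c ≡ false
unit∉⇒lookup≡false p↓ c c-unused v pv with lookup v c in eq
... | false = refl
... | true  = ⊥-elim (c-unused (p↓ v (unit c) (unit-≼ v c eq) pv))

insertAt-injective : {m : ℕ} {A : Set} (c : Fin (suc m)) (x : A) {u v : Vec A m} →
                     insertAt u c x ≡ insertAt v c x → u ≡ v
insertAt-injective c x {u} {v} eq = begin
  u                                ≡⟨ removeAt-insertAt u c x ⟨
  removeAt (insertAt u c x) c      ≡⟨ cong (λ w → removeAt w c) eq ⟩
  removeAt (insertAt v c x) c      ≡⟨ removeAt-insertAt v c x ⟩
  v                                ∎
  where open ≡.≡-Reasoning

QAdj-insertAt : {m : ℕ} (c : Fin (suc m)) (x : Bool) (u v : Vec Bool m) →
                QAdj (insertAt u c x) (insertAt v c x) ⇔ QAdj u v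
QAdj-insertAt zero x u v = mk⇔ (λ { (inj₁ (x≢x , _)) → ⊥-elim (x≢x refl) ; (inj₂ (_ , adj)) → adj })
                               (λ adj → inj₂ (refl , adj))
QAdj-insertAt (suc c) x (y ∷ u) (z ∷ v) = mk⇔
  (λ { (inj₁ (y≢z , eq))  → inj₁ (y≢z , insertAt-injective c x eq)
     ; (inj₂ (y≡z , adj)) → inj₂ (y≡z , ⇔.to (QAdj-insertAt c x u v) adj) })
  (λ { (inj₁ (y≢z , eq))  → inj₁ (y≢z , cong (λ w → insertAt w c x) eq)
     ; (inj₂ (y≡z , adj)) → inj₂ (y≡z , ⇔.from (QAdj-insertAt c x u v) adj) })

insertAt-≼ : {m : ℕ} (c : Fin (suc m)) {u v : Vec Bool m} → u ≼ v → insertAt u c false ≼ insertAt v c false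
insertAt-≼ zero                        u≼v = u≼v
insertAt-≼ (suc c) {true  ∷ u} {true  ∷ v} u≼v = insertAt-≼ c u≼v
insertAt-≼ (suc c) {false ∷ u} {true  ∷ v} u≼v = insertAt-≼ c u≼v
insertAt-≼ (suc c) {false ∷ u} {false ∷ v} u≼v = insertAt-≼ c u≼v

insertAt-𝟘 : {m : ℕ} (c : Fin (suc m)) → insertAt 𝟘 c false ≡ 𝟘
insertAt-𝟘 zero              = refl
insertAt-𝟘 {suc m} (suc c) = cong (false ∷_) (insertAt-𝟘 c)

without : {m : ℕ} → DownSet (suc m) → Fin (suc m) → DownSet m
without D c = record
  { member     = λ w → member (insertAt w c false)
  ; downClosed = λ u v v≼u → downClosed _ _ (insertAt-≼ c v≼u)
  ; has-𝟘      = subst (T ∘ member) (≡.sym (insertAt-𝟘 c)) has-𝟘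
  }
  where open DownSet D

without-≅ : {m : ℕ} (D : DownSet (suc m)) (c : Fin (suc m)) → ¬ T (DownSet.member D (unit c)) →
            ⟪ D ⟫ ≅ ⟪ without D c ⟫
without-≅ D c c-unused = record
  { to      = λ (v , pv) → removeAt v c , subst (T ∘ member) (≡.sym (reinsert v pv)) pv
  ; from    = λ (w , pw) → insertAt w c false , pw
  ; from∘to = λ (v , pv) → Induced-≡ (reinsert v pv) _ _
  ; to∘from = λ (w , pw) → Induced-≡ (removeAt-insertAt w c false) _ _
  ; adj     = λ (u , pu) (v , pv) →
      ⇔-trans (≡⇒⇔ (cong₂ QAdj (≡.sym (reinsert u pu)) (≡.sym (reinsert v pv))))
              (QAdj-insertAt c false (removeAt u c) (removeAt v c))
  }
  where
  open DownSet D
  reinsert : ∀ v → T (member v) → insertAt (removeAt v c) c false ≡ v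
  reinsert v pv = subst (λ x → insertAt (removeAt v c) c x ≡ v) (unit∉⇒lookup≡false downClosed c c-unused v pv)
                        (insertAt-removeAt v c)

≅-SpanningRep : {G H : Graph} {m : ℕ} → G ≅ H → SpanningRep H m → SpanningRep G m
≅-SpanningRep φ (D , spanning , ψ) = D , spanning , ≅-trans φ ψ

trim-DownSet : {m : ℕ} (D : DownSet m) → ∃ (SpanningRep ⟪ D ⟫)
trim-DownSet {zero} D = 0 , D , (λ ()) , ≅-refl _
trim-DownSet {suc m} D with all? (λ c → T? (DownSet.member D (unit c)))
... | yes spanning = suc m , D , spanning , ≅-refl _
... | no ¬spanning with ¬∀⟶∃¬ (suc m) _ (λ c → T? (DownSet.member D (unit c))) ¬spanning
...   | c , c-unused with trim-DownSet (without D c)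
...     | m′ , rep = m′ , ≅-SpanningRep (without-≅ D c c-unused) rep

trim : {G : Graph} {m : ℕ} → DaisyRep G m → ∃ (SpanningRep G)
trim (D , φ) with trim-DownSet D
... | m′ , rep = m′ , ≅-SpanningRep φ rep

belowSome⁺ : {m : ℕ} {X : List (Vec Bool m)} {x : Vec Bool m} (v : Vec Bool m) →
             x ∈ X → v ≼ x → T (belowSome X v)
belowSome⁺ v (here refl) v≼x = ⇔.from T-∨ (inj₁ v≼x)
belowSome⁺ v (there x∈X) v≼x = ⇔.from T-∨ (inj₂ (belowSome⁺ v x∈X v≼x))

belowSome⁻ : {m : ℕ} (X : List (Vec Bool m)) (v : Vec Bool m) → T (belowSome X v) → ∃ λ x → x ∈ X × v ≼ x
belowSome⁻ (x ∷ X) v h with ⇔.to T-∨ h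
... | inj₁ v≼x = x , here refl , v≼x
... | inj₂ h′ with belowSome⁻ X v h′
...   | y , y∈X , v≼y = y , there y∈X , v≼y

below : {m : ℕ} (X : List (Vec Bool m)) → NonEmpty X → DownSet m
below {m} X X≢[] = record
  { member     = belowSome X
  ; downClosed = λ u v v≼u u∈↓X → let x , x∈X , u≼x = belowSome⁻ X u u∈↓X in
                                   belowSome⁺ v x∈X (≼-trans v u x v≼u u≼x)
  ; has-𝟘      = 𝟘∈↓ X X≢[]
  }
  where
  𝟘∈↓ : (X : List (Vec Bool m)) → NonEmpty X → T (belowSome X 𝟘)
  𝟘∈↓ (x ∷ xs) _ = belowSome⁺ {X = x ∷ xs} 𝟘 (here refl) (𝟘-≼ x)

IsDaisyCube⇒DaisyRep : {G : Graph} → IsDaisyCube G → ∃ (DaisyRep G)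
IsDaisyCube⇒DaisyRep (m , X , X≢[] , φ) = m , below X X≢[] , φ

Induced-cong : {m : ℕ} {p q : Vec Bool m → Bool} → (∀ v → T (p v) ⇔ T (q v)) → Induced m p ≅ Induced m q
Induced-cong p⇔q = record
  { to      = λ (v , pv) → v , ⇔.to (p⇔q v) pv
  ; from    = λ (v , qv) → v , ⇔.from (p⇔q v) qv
  ; from∘to = λ (v , _) → Induced-≡ refl _ _
  ; to∘from = λ (v , _) → Induced-≡ refl _ _
  ; adj     = λ _ _ → ⇔-refl _
  }

allVecs : (m : ℕ) → List (Vec Bool m)
allVecs zero    = [] ∷ []
allVecs (suc m) = cartesianProductWith _∷_ (true ∷ false ∷ []) (allVecs m)

∈-allVecs : {m : ℕ} (v : Vec Bool m) → v ∈ allVecs m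
∈-allVecs []          = here refl
∈-allVecs (true  ∷ v) = ∈-cartesianProductWith⁺ _∷_ {xs = true ∷ false ∷ []} (here refl) (∈-allVecs v)
∈-allVecs (false ∷ v) = ∈-cartesianProductWith⁺ _∷_ {xs = true ∷ false ∷ []} (there (here refl)) (∈-allVecs v)

elements : {m : ℕ} → DownSet m → List (Vec Bool m)
elements {m} D = filter (T? ∘ DownSet.member D) (allVecs m)

belowSome-elements : {m : ℕ} (D : DownSet m) (v : Vec Bool m) → T (DownSet.member D v) ⇔ T (belowSome (elements D) v)
belowSome-elements D v = mk⇔
  (λ v∈D → belowSome⁺ v (∈-filter⁺ (T? ∘ member) (∈-allVecs v) v∈D) (≼-refl v))
  (λ v∈↓ → let x , x∈X , v≼x = belowSome⁻ (elements D) v v∈↓ in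
           downClosed x v v≼x (proj₂ (∈-filter⁻ (T? ∘ member) {xs = allVecs _} x∈X)))
  where open DownSet D

∈⇒NonEmpty : {A : Set} {x : A} {xs : List A} → x ∈ xs → NonEmpty xs
∈⇒NonEmpty (here _)  = tt
∈⇒NonEmpty (there _) = tt

DaisyRep⇒IsDaisyCube : {G : Graph} {m : ℕ} → DaisyRep G m → IsDaisyCube G
DaisyRep⇒IsDaisyCube {m = m} (D , φ) =
  m , elements D , ∈⇒NonEmpty (∈-filter⁺ (T? ∘ member) (∈-allVecs 𝟘) has-𝟘) ,
  ≅-trans φ (Induced-cong (belowSome-elements D))
  where open DownSet D

IsDaisyCube×Idim⇔SpanningRep : {G : Graph} {m : ℕ} → (IsDaisyCube G × Idim G m) ⇔ SpanningRep G m
IsDaisyCube×Idim⇔SpanningRep {G} = mk⇔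
  (λ (daisy , idim) → let m′ , rep = trim (proj₂ (IsDaisyCube⇒DaisyRep daisy)) in
                      subst (SpanningRep G) (Idim-unique (Idim-SpanningRep rep) idim) rep)
  (λ rep@(D , _ , φ) → DaisyRep⇒IsDaisyCube (D , φ) , Idim-SpanningRep rep)

-- Cartesian products

□-Adj : (G H : Graph) → V G × V H → V G × V H → Set
□-Adj G H (x , y) (x′ , y′) = (Adj G x x′ × y ≡ y′) ⊎ (x ≡ x′ × Adj H y y′)

infixr 30 _□_

_□_ : Graph → Graph → Graph
G □ H = record
  { V      = V G × V H
  ; Adj    = □-Adj G H
  ; sym    = λ { (inj₁ (x∼x′ , y≡y′)) → inj₁ (sym G x∼x′ , ≡.sym y≡y′)
               ; (inj₂ (x≡x′ , y∼y′)) → inj₂ (≡.sym x≡x′ , sym H y∼y′) }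
  ; irrefl = λ { (inj₁ (x∼x , _)) → irrefl G x∼x ; (inj₂ (_ , y∼y)) → irrefl H y∼y }
  }

CartProd-suc-≅ : (t : ℕ) (R : Fin (suc t) → Graph) → CartProd (suc t) R ≅ R zero □ CartProd t (R ∘ suc)
CartProd-suc-≅ t R = record
  { to = id ; from = id ; from∘to = λ _ → refl ; to∘from = λ _ → refl ; adj = λ _ _ → ⇔-refl _ }

□-comm : (G H : Graph) → G □ H ≅ H □ G
□-comm G H = record
  { to      = swap
  ; from    = swap
  ; from∘to = λ _ → refl
  ; to∘from = λ _ → refl
  ; adj     = λ _ _ → mk⇔ flip-adj flip-adj′
  }
  where
  flip-adj : ∀ {u v} → □-Adj G H u v → □-Adj H G (swap u) (swap v)
  flip-adj (inj₁ (x∼x′ , y≡y′)) = inj₂ (y≡y′ , x∼x′)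
  flip-adj (inj₂ (x≡x′ , y∼y′)) = inj₁ (y∼y′ , x≡x′)
  flip-adj′ : ∀ {u v} → □-Adj H G (swap u) (swap v) → □-Adj G H u v
  flip-adj′ (inj₁ (y∼y′ , x≡x′)) = inj₂ (x≡x′ , y∼y′)
  flip-adj′ (inj₂ (y≡y′ , x∼x′)) = inj₁ (x∼x′ , y≡y′)

□-cong : {G G′ H H′ : Graph} → G ≅ G′ → H ≅ H′ → G □ H ≅ G′ □ H′
□-cong {G} {G′} {H} {H′} φ ψ = record
  { to      = Product.map (to φ) (to ψ)
  ; from    = Product.map (from φ) (from ψ)
  ; from∘to = λ (x , y) → cong₂ _,_ (from∘to φ x) (from∘to ψ y)
  ; to∘from = λ (x , y) → cong₂ _,_ (to∘from φ x) (to∘from ψ y)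
  ; adj     = λ (x , y) (x′ , y′) → mk⇔
      (λ { (inj₁ (x∼x′ , y≡y′)) → inj₁ (⇔.to (adj φ x x′) x∼x′ , cong (to ψ) y≡y′)
         ; (inj₂ (x≡x′ , y∼y′)) → inj₂ (cong (to φ) x≡x′ , ⇔.to (adj ψ y y′) y∼y′) })
      (λ { (inj₁ (x∼x′ , y≡y′)) → inj₁ (⇔.from (adj φ x x′) x∼x′ , ≅-injective ψ y≡y′)
         ; (inj₂ (x≡x′ , y∼y′)) → inj₂ (≅-injective φ x≡x′ , ⇔.from (adj ψ y y′) y∼y′) })
  }

𝟘-++ : {a b : ℕ} → 𝟘 {a} ++ 𝟘 {b} ≡ 𝟘
𝟘-++ {zero}  = refl
𝟘-++ {suc a} = cong (false ∷_) (𝟘-++ {a})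

unit-++ : {a b : ℕ} (c : Fin (a + b)) →
          (∃ λ c₁ → unit c ≡ unit c₁ ++ 𝟘 {b}) ⊎ (∃ λ c₂ → unit c ≡ 𝟘 {a} ++ unit c₂)
unit-++ {zero}  c       = inj₂ (c , refl)
unit-++ {suc a} zero    = inj₁ (zero , cong (true ∷_) (≡.sym (𝟘-++ {a})))
unit-++ {suc a} (suc c) with unit-++ {a} c
... | inj₁ (c₁ , eq) = inj₁ (suc c₁ , cong (false ∷_) eq)
... | inj₂ (c₂ , eq) = inj₂ (c₂ , cong (false ∷_) eq)

take-drop-++ : {A : Set} {a b : ℕ} (u : Vec A a) (v : Vec A b) → take a (u ++ v) ≡ u × drop a (u ++ v) ≡ v
take-drop-++ {a = a} u v = ++-injective (take a (u ++ v)) u (take++drop≡id a (u ++ v))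

≼-take-drop : (a : ℕ) {b : ℕ} {u v : Vec Bool (a + b)} → u ≼ v → take a u ≼ take a v × drop a u ≼ drop a v
≼-take-drop zero                            u≼v = tt , u≼v
≼-take-drop (suc a) {u = true  ∷ u} {true  ∷ v} u≼v = ≼-take-drop a u≼v
≼-take-drop (suc a) {u = false ∷ u} {true  ∷ v} u≼v = ≼-take-drop a u≼v
≼-take-drop (suc a) {u = false ∷ u} {false ∷ v} u≼v = ≼-take-drop a u≼v

QAdj-++ : {a b : ℕ} (u u′ : Vec Bool a) (v v′ : Vec Bool b) →
          QAdj (u ++ v) (u′ ++ v′) ⇔ ((QAdj u u′ × v ≡ v′) ⊎ (u ≡ u′ × QAdj v v′))
QAdj-++ [] [] v v′ = mk⇔ (λ v∼v′ → inj₂ (refl , v∼v′))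
                         (λ { (inj₁ (() , _)) ; (inj₂ (_ , v∼v′)) → v∼v′ })
QAdj-++ (x ∷ u) (x′ ∷ u′) v v′ = mk⇔ split join
  where
  split : QAdj (x ∷ u ++ v) (x′ ∷ u′ ++ v′) →
          (QAdj (x ∷ u) (x′ ∷ u′) × v ≡ v′) ⊎ (x ∷ u ≡ x′ ∷ u′ × QAdj v v′)
  split (inj₁ (x≢x′ , eq)) =
    let u≡u′ , v≡v′ = ++-injective u u′ eq in inj₁ (inj₁ (x≢x′ , u≡u′) , v≡v′)
  split (inj₂ (refl , adj′)) with ⇔.to (QAdj-++ u u′ v v′) adj′
  ... | inj₁ (u∼u′ , v≡v′) = inj₁ (inj₂ (refl , u∼u′) , v≡v′)
  ... | inj₂ (u≡u′ , v∼v′) = inj₂ (cong (x ∷_) u≡u′ , v∼v′)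
  join : (QAdj (x ∷ u) (x′ ∷ u′) × v ≡ v′) ⊎ (x ∷ u ≡ x′ ∷ u′ × QAdj v v′) →
         QAdj (x ∷ u ++ v) (x′ ∷ u′ ++ v′)
  join (inj₁ (inj₁ (x≢x′ , refl) , refl)) = inj₁ (x≢x′ , refl)
  join (inj₁ (inj₂ (refl , u∼u′) , v≡v′)) = inj₂ (refl , ⇔.from (QAdj-++ u u′ v v′) (inj₁ (u∼u′ , v≡v′)))
  join (inj₂ (refl , v∼v′))               = inj₂ (refl , ⇔.from (QAdj-++ u u v v′) (inj₂ (refl , v∼v′)))

_∧ᵛ_ : {a b : ℕ} → (Vec Bool a → Bool) → (Vec Bool b → Bool) → Vec Bool (a + b) → Bool
_∧ᵛ_ {a} p q w = p (take a w) ∧ q (drop a w)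

T-∧ᵛ-++ : {a b : ℕ} (p : Vec Bool a → Bool) (q : Vec Bool b → Bool) (u : Vec Bool a) (v : Vec Bool b) →
          T ((p ∧ᵛ q) (u ++ v)) ⇔ (T (p u) × T (q v))
T-∧ᵛ-++ p q u v =
  ⇔-trans (≡⇒⇔ (cong T (cong₂ (λ u′ v′ → p u′ ∧ q v′) (proj₁ (take-drop-++ u v)) (proj₂ (take-drop-++ u v))))) T-∧

_⊗_ : {a b : ℕ} → DownSet a → DownSet b → DownSet (a + b)
_⊗_ {a} D E = record
  { member     = D.member ∧ᵛ E.member
  ; downClosed = λ u v v≼u uD∧uE → let v≼u₁ , v≼u₂ = ≼-take-drop a v≼u ; uD , uE = ⇔.to T-∧ uD∧uE in
                   ⇔.from T-∧ (D.downClosed _ _ v≼u₁ uD , E.downClosed _ _ v≼u₂ uE)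
  ; has-𝟘      = subst (T ∘ (D.member ∧ᵛ E.member)) (𝟘-++ {a})
                       (⇔.from (T-∧ᵛ-++ D.member E.member 𝟘 𝟘) (D.has-𝟘 , E.has-𝟘))
  }
  where
  module D = DownSet D
  module E = DownSet E

module _ {a b : ℕ} (D : DownSet a) (E : DownSet b) where
  private
    module D = DownSet D
    module E = DownSet E

  ⊗-spanning : Spanning D.member → Spanning E.member → Spanning (DownSet.member (D ⊗ E))
  ⊗-spanning D-spanning E-spanning c with unit-++ {a} {b} c
  ... | inj₁ (c₁ , eq) = subst (T ∘ D.member ∧ᵛ E.member) (≡.sym eq)
                           (⇔.from (T-∧ᵛ-++ D.member E.member (unit c₁) 𝟘) (D-spanning c₁ , E.has-𝟘))
  ... | inj₂ (c₂ , eq) = subst (T ∘ D.member ∧ᵛ E.member) (≡.sym eq)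
                           (⇔.from (T-∧ᵛ-++ D.member E.member 𝟘 (unit c₂)) (D.has-𝟘 , E-spanning c₂))

  □-≅-⊗ : ⟪ D ⟫ □ ⟪ E ⟫ ≅ ⟪ D ⊗ E ⟫
  □-≅-⊗ = record
    { to      = λ ((u , pu) , (v , pv)) → u ++ v , ⇔.from (T-∧ᵛ-++ D.member E.member u v) (pu , pv)
    ; from    = λ (w , pw) → (take a w , proj₁ (⇔.to T-∧ pw)) , (drop a w , proj₂ (⇔.to T-∧ pw))
    ; from∘to = λ ((u , _) , (v , _)) → cong₂ _,_ (Induced-≡ (proj₁ (take-drop-++ u v)) _ _)
                                                  (Induced-≡ (proj₂ (take-drop-++ u v)) _ _)
    ; to∘from = λ (w , _) → Induced-≡ (take++drop≡id a w) _ _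
    ; adj     = λ ((u , _) , (v , _)) ((u′ , _) , (v′ , _)) →
                  ⇔-trans (mk⇔ (Sum.map (Product.map₂ (cong proj₁)) (Product.map₁ (cong proj₁)))
                               (Sum.map (Product.map₂ (λ eq → Induced-≡ eq _ _))
                                        (Product.map₁ (λ eq → Induced-≡ eq _ _))))
                          (⇔-sym (QAdj-++ u u′ v v′))
    }

□-SpanningRep : {G H : Graph} {a b : ℕ} → SpanningRep G a → SpanningRep H b → SpanningRep (G □ H) (a + b)
□-SpanningRep (D , D-spanning , φ) (E , E-spanning , ψ) =
  D ⊗ E , ⊗-spanning D E D-spanning E-spanning , ≅-trans (□-cong φ ψ) (□-≅-⊗ D E)

-- Factoring daisy representations of products

□-project : {G H : Graph} {x x′ : V G} {y y′ : V H} {L : ℕ} → Walk (G □ H) (x , y) (x′ , y′) L →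
          ∃ λ k → Walk G x x′ k × k ≤ L × (y ≢ y′ → k < L)
□-project here = 0 , here , z≤n , λ y≢y → ⊥-elim (y≢y refl)
□-project (step (inj₁ (x∼w , y≡y₁)) rest) =
  let k , p , k≤L , shorter = □-project rest in
  suc k , step x∼w p , s≤s k≤L , λ y≢y′ → s≤s (shorter (λ y₁≡y′ → y≢y′ (trans y≡y₁ y₁≡y′)))
□-project (step (inj₂ (x≡x₁ , _)) rest) =
  let k , p , k≤L , _ = □-project rest in
  k , substʷ (≡.sym x≡x₁) refl p , m≤n⇒m≤1+n k≤L , λ _ → s≤s k≤L

□-lift : {G H : Graph} (y : V H) {x x′ : V G} {k : ℕ} → Walk G x x′ k → Walk (G □ H) (x , y) (x′ , y) k
□-lift y = mapWalk (_, y) (λ x∼x′ → inj₁ (x∼x′ , refl))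

module Fibre {G H : Graph} {m : ℕ} (D : DownSet m) (φ : G □ H ≅ ⟪ D ⟫) where
  open DownSet D

  o : V ⟪ D ⟫
  o = 𝟘 , has-𝟘

  layer : V ⟪ D ⟫ → V H
  layer = proj₂ ∘ from φ

  b : V H
  b = layer o

  _≟ᴴ_ : DecidableEquality (V H)
  y ≟ᴴ y′ = map′ (cong proj₂) (cong (proj₁ (from φ o) ,_)) (≅-Induced-≟ φ (_ , y) (_ , y′))

  InFibre : Vec Bool m → Set
  InFibre v = Σ (T (member v)) λ pv → layer (v , pv) ≡ b

  InFibre? : (v : Vec Bool m) → Dec (InFibre v)
  InFibre? v with T? (member v)
  ... | no  v∉D = no (v∉D ∘ proj₁)
  ... | yes pv  = map′ (pv ,_) (λ (pv′ , eq) → trans (cong (λ pv → layer (v , pv)) (T-irrelevant pv pv′)) eq)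
                       (layer (v , pv) ≟ᴴ b)

  pulled-geodesic : (u v : Vec Bool m) (pu : T (member u)) (pv : T (member v)) →
                    Walk (G □ H) (from φ (u , pu)) (from φ (v , pv)) (ham u v)
  pulled-geodesic u v pu pv = ≅-walk (≅-sym φ) (geodesic member downClosed u v pu pv)

  -- If v ≼ u left the fibre, a geodesic from 𝟘 through v to u would project to a walk in G that,
  -- lifted back to the fibre, reaches u in fewer than ham 𝟘 u steps.
  layer-stable : (u v : Vec Bool m) (pu : T (member u)) (pv : T (member v)) → v ≼ u →
                 layer (u , pu) ≡ b → layer (v , pv) ≡ b
  layer-stable u v pu pv v≼u u∈F with layer (v , pv) ≟ᴴ b
  ... | yes v∈F = v∈F
  ... | no  v∉F with □-project (pulled-geodesic 𝟘 v has-𝟘 pv) | □-project (pulled-geodesic v u pv pu)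
  ...   | k₁ , o⇝v , _ , shorter | k₂ , v⇝u , k₂≤ , _ =
    ⊥-elim (<⇒≱ shortcut-length (walk⇒ham≤ proj₁ id shortcut))
    where
    shortcut-length : k₁ + k₂ < ham 𝟘 u
    shortcut-length = subst (k₁ + k₂ <_) (ham-𝟘-split u v v≼u) (+-mono-<-≤ (shorter (v∉F ∘ ≡.sym)) k₂≤)
    shortcut : Walk ⟪ D ⟫ o (u , pu) (k₁ + k₂)
    shortcut = substʷ (to∘from φ o)
                      (trans (cong (λ y → to φ (proj₁ (from φ (u , pu)) , y)) (≡.sym u∈F)) (to∘from φ (u , pu)))
                      (≅-walk φ (□-lift b (o⇝v ++ʷ v⇝u)))

  fibre : DownSet m
  fibre = record
    { member     = λ v → ⌊ InFibre? v ⌋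
    ; downClosed = λ u v v≼u u∈F → let pu , eq = toWitness u∈F ; pv = downClosed u v v≼u pu in
                                   fromWitness (pv , layer-stable u v pu pv v≼u eq)
    ; has-𝟘      = fromWitness (has-𝟘 , refl)
    }

  fibre-≅ : G ≅ ⟪ fibre ⟫
  fibre-≅ = record
    { to      = λ x → proj₁ (to φ (x , b)) ,
                      fromWitness (proj₂ (to φ (x , b)) , cong proj₂ (from∘to φ (x , b)))
    ; from    = λ (v , v∈F) → proj₁ (from φ (v , proj₁ (toWitness v∈F)))
    ; from∘to = λ x → trans (cong (proj₁ ∘ from φ) (Induced-≡ refl _ _)) (cong proj₁ (from∘to φ (x , b)))
    ; to∘from = λ (v , v∈F) → let pv , eq = toWitness v∈F in
                  Induced-≡ (cong proj₁ (trans (cong (λ y → to φ (proj₁ (from φ (v , pv)) , y)) (≡.sym eq))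
                                            (to∘from φ (v , pv)))) _ _
    ; adj     = λ x y → ⇔-trans (mk⇔ (λ x∼y → inj₁ (x∼y , refl)) within-layer) (adj φ (x , b) (y , b))
    }
    where
    within-layer : {x y : V G} → □-Adj G H (x , b) (y , b) → Adj G x y
    within-layer (inj₁ (x∼y , _)) = x∼y
    within-layer (inj₂ (_ , b∼b)) = ⊥-elim (irrefl H b∼b)

□-factorˡ : {G H : Graph} {m : ℕ} → DaisyRep (G □ H) m → DaisyRep G m
□-factorˡ (D , φ) = Fibre.fibre D φ , Fibre.fibre-≅ D φ

□-factorʳ : {G H : Graph} {m : ℕ} → DaisyRep (G □ H) m → DaisyRep H m
□-factorʳ {G} {H} rep = □-factorˡ (≅-DaisyRep (□-comm H G) rep)

SpanningRep⇒DaisyRep : {G : Graph} {m : ℕ} → SpanningRep G m → DaisyRep G m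
SpanningRep⇒DaisyRep (D , _ , φ) = D , φ

CartProd-SpanningRep : (t : ℕ) (R : Fin t → Graph) (ns : Fin t → ℕ) →
                       (∀ i → SpanningRep (R i) (ns i)) → SpanningRep (CartProd t R) (sumFin t ns)
CartProd-SpanningRep zero R ns _ = point , (λ ()) , record
  { to = λ _ → [] , tt ; from = λ _ → tt ; from∘to = λ _ → refl ; to∘from = λ { ([] , tt) → refl }
  ; adj = λ _ _ → ⇔-refl _ }
  where
  point : DownSet 0
  point = record { member = λ _ → true ; downClosed = λ _ _ _ _ → tt ; has-𝟘 = tt }
CartProd-SpanningRep (suc t) R ns reps = ≅-SpanningRep (CartProd-suc-≅ t R)
  (□-SpanningRep (reps zero) (CartProd-SpanningRep t (R ∘ suc) (ns ∘ suc) (reps ∘ suc)))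

CartProd-factor : (t : ℕ) (R : Fin t → Graph) {m : ℕ} → DaisyRep (CartProd t R) m → ∀ i → DaisyRep (R i) m
CartProd-factor (suc t) R rep zero    = □-factorˡ (≅-DaisyRep (≅-sym (CartProd-suc-≅ t R)) rep)
CartProd-factor (suc t) R rep (suc i) =
  CartProd-factor t (R ∘ suc) (□-factorʳ (≅-DaisyRep (≅-sym (CartProd-suc-≅ t R)) rep)) i

corollary4p2 : (t : ℕ) (R : Fin t → Graph) → (∀ i → Nontrivial (R i)) →
    (n : ℕ) → 0 < n →
    (IsDaisyCube (CartProd t R) × Idim (CartProd t R) n) ⇔
    Σ (Fin t → ℕ) (λ ns → (∀ i → 0 < ns i) × (∀ i → IsDaisyCube (R i) × Idim (R i) (ns i)) × n ≡ sumFin t ns)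
corollary4p2 t R nontrivial n _ = mk⇔ forward backward
  where
  Factorisation : Set
  Factorisation =
    Σ (Fin t → ℕ) (λ ns → (∀ i → 0 < ns i) × (∀ i → IsDaisyCube (R i) × Idim (R i) (ns i)) × n ≡ sumFin t ns)

  forward : IsDaisyCube (CartProd t R) × Idim (CartProd t R) n → Factorisation
  forward daisy-idim =
    proj₁ ∘ factors ,
    (λ i → DaisyRep-dim>0 (nontrivial i) (SpanningRep⇒DaisyRep (proj₂ (factors i)))) ,
    (λ i → ⇔.from IsDaisyCube×Idim⇔SpanningRep (proj₂ (factors i))) ,
    Idim-unique (proj₂ daisy-idim) (Idim-SpanningRep (CartProd-SpanningRep t R _ (proj₂ ∘ factors)))
    where
    factors : ∀ i → ∃ (SpanningRep (R i))
    factors = trim ∘ CartProd-factor t R (SpanningRep⇒DaisyRep (⇔.to IsDaisyCube×Idim⇔SpanningRep daisy-idim))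

  backward : Factorisation → IsDaisyCube (CartProd t R) × Idim (CartProd t R) n
  backward (ns , _ , daisy-idims , refl) = ⇔.from IsDaisyCube×Idim⇔SpanningRep
    (CartProd-SpanningRep t R ns (⇔.to IsDaisyCube×Idim⇔SpanningRep ∘ daisy-idims))
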